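{- Let $\mathcal{B}_n$ be the standard crystal of type $A_{n-1}$ and $k\ge1$. Then every connected component of the $k$-fold quasi-tensor power $\mathcal{B}_n^{\mathbin{\ddot\otimes}k}$ satisfies the local quasi-crystal axioms LQ1, LQ2, LQ3, LQ3$'$.
   Context: Fix $n\ge 2$, $I=\{1,\dots,n-1\}$, weights in $\mathbb{Z}^n$ with standard inner product, $\alpha_i=\mathbf{e}_i-\mathbf{e}_{i+1}$; on $\mathbb{Z}\sqcup\{\pm\infty\}$, $m+(\pm\infty)=\pm\infty$. A quasi-crystal of type $A_{n-1}$ is a non-empty set $\mathcal{Q}$ with maps $\ddot e_i,\ddot f_i:\mathcal{Q}\to\mathcal{Q}\sqcup\{\bot\}$, $\ddot\varepsilon_i,\ddot\varphi_i:\mathcal{Q}\to\mathbb{Z}\sqcup\{\pm\infty\}$, $\mathrm{wt}:\mathcal{Q}\to\mathbb{Z}^n$ with: (Q1) $\ddot e_i(x)=y\iff x=\ddot f_i(y)$, and then $\mathrm{wt}(y)=\mathrm{wt}(x)+\alpha_i$, $\ddot\varepsilon_i(y)=\ddot\varepsilon_i(x)-1$, $\ddot\varphi_i(y)=\ddot\varphi_i(x)+1$; (Q2) $\ddot\varphi_i(x)=\ddot\varepsilon_i(x)+\langle\mathrm{wt}(x),\alpha_i\rangle$; (Q3),(Q4) if $\ddot\varepsilon_i(x)=\pm\infty$ then $\ddot e_i(x)=\ddot f_i(x)=\bot$. Local axioms (all $i,j\in I$, $x,y$): (LQ1) for $i+1\in I$: $\ddot\varepsilon_i(x)=0\iff\ddot\varphi_{i+1}(x)=0$.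 (LQ2) if $\ddot e_i(x)=y$: (1) $\ddot\varepsilon_j(x)=\ddot\varepsilon_j(y)$ for $|i-j|>1$; (2) if $i+1\in I$: $\ddot\varepsilon_{i+1}(x)\ne\ddot\varepsilon_{i+1}(y)$ iff ($\ddot\varepsilon_{i+1}(x)=+\infty$ and $\ddot\varepsilon_i(y)=0$), and then $\ddot\varepsilon_{i+1}(y)\ne0$; (3) if $i-1\in I$: $\ddot\varphi_{i-1}(x)\ne\ddot\varphi_{i-1}(y)$ iff ($\ddot\varphi_{i-1}(y)=+\infty$ and $\ddot\varphi_i(x)=0$), and then $\ddot\varphi_{i-1}(x)\ne0$. (LQ3) for $i\ne j$, if $\ddot e_i(x)\ne\bot\ne\ddot e_j(x)$ then $\ddot e_i\ddot e_j(x)=\ddot e_j\ddot e_i(x)\ne\bot$. (LQ3$'$) same with $\ddot f$. The standard crystal $\mathcal{B}_n$ is the set $\{1,\dots,n\}$ with $\mathrm{wt}(j)=\mathbf{e}_j$, $\ddot f_i(i)=i+1$ and $\ddot f_i(j)=\bot$ for $j\ne i$, $\ddot e_i(i+1)=i$ and $\ddot e_i(j)=\bot$ for $j\ne i+1$, $\ddot\varphi_i(j)=\delta_{i,j}$, $\ddot\varepsilon_i(j)=\delta_{i+1,j}$. Quasi-tensor product of seminormal quasi-crystals $\mathcal{Q},\mathcal{Q}'$: the set of $x\mathbin{\ddot\otimes}x'$ with $\mathrm{wt}(x\mathbin{\ddot\otimes}x')=\mathrm{wt}(x)+\mathrm{wt}(x')$ and for each $i$: if $\ddot\varphi_i(x)>0$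 and $\ddot\varepsilon_i(x')>0$ then $\ddot e_i,\ddot f_i$ give $\bot$ and $\ddot\varepsilon_i=\ddot\varphi_i=+\infty$ on $x\mathbin{\ddot\otimes}x'$; otherwise $\ddot e_i(x\mathbin{\ddot\otimes}x')=\ddot e_i(x)\mathbin{\ddot\otimes}x'$ if $\ddot\varphi_i(x)\ge\ddot\varepsilon_i(x')$, else $x\mathbin{\ddot\otimes}\ddot e_i(x')$; $\ddot f_i(x\mathbin{\ddot\otimes}x')=\ddot f_i(x)\mathbin{\ddot\otimes}x'$ if $\ddot\varphi_i(x)>\ddot\varepsilon_i(x')$, else $x\mathbin{\ddot\otimes}\ddot f_i(x')$; $\ddot\varepsilon_i(x\mathbin{\ddot\otimes}x')=\max\{\ddot\varepsilon_i(x),\ddot\varepsilon_i(x')-\langle\mathrm{wt}(x),\alpha_i\rangle\}$, $\ddot\varphi_i(x\mathbin{\ddot\otimes}x')=\max\{\ddot\varphi_i(x)+\langle\mathrm{wt}(x'),\alpha_i\rangle,\ddot\varphi_i(x')\}$; with $x\mathbin{\ddot\otimes}\bot=\bot\mathbin{\ddot\otimes}x'=\bot$. The power $\mathcal{B}_n^{\mathbin{\ddot\otimes}k}$ is the iterated quasi-tensor product of $k$ copies of $\mathcal{B}_n$ (e.g. $\mathcal{B}_n^{\mathbin{\ddot\otimes}k}=\mathcal{B}_n^{\mathbin{\ddot\otimes}(k-1)}\mathbin{\ddot\otimes}\mathcal{B}_n$). A connected component is taken in the graph with an $i$-edge $x\to y$ iff $\ddot f_i(x)=y$, with the restricted maps.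 -}

module Defs where

open import Data.Nat as ℕ using (ℕ; zero; suc; _<_; _≤_; _<?_; _≡ᵇ_)
open import Data.Integer as ℤ using (ℤ; 0ℤ; 1ℤ; _-_; _⊔_; _≤ᵇ_)
open import Data.Fin using (Fin; toℕ; fromℕ<)
import Data.Fin as Fin
open import Data.Bool using (Bool; true; false; if_then_else_; _∧_; not)
open import Data.Maybe using (Maybe; just; nothing; map)
open import Data.Product using (_×_; _,_; Σ; ∃)
open import Data.Sum using (_⊎_)
open import Data.Empty using (⊥)
open import Relation.Nullary using (¬_; does)
open import Relation.Binary.PropositionalEquality using (_≡_)
open import Relation.Binary.Construct.Closure.Equivalence using (EqClosure)
open import Function.Bundles using (_⇔_)

data ℤ∞ : Set where
  -∞ : ℤ∞
  +∞ : ℤ∞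
  fin : ℤ → ℤ∞

_⊕∞_ : ℤ∞ → ℤ → ℤ∞
-∞ ⊕∞ m = -∞
+∞ ⊕∞ m = +∞
fin a ⊕∞ m = fin (a ℤ.+ m)

max∞ : ℤ∞ → ℤ∞ → ℤ∞
max∞ -∞ b = b
max∞ +∞ b = +∞
max∞ (fin a) -∞ = fin a
max∞ (fin a) +∞ = +∞
max∞ (fin a) (fin b) = fin (a ⊔ b)

_≤∞ᵇ_ : ℤ∞ → ℤ∞ → Bool
-∞ ≤∞ᵇ b = true
+∞ ≤∞ᵇ +∞ = true
+∞ ≤∞ᵇ _ = false
fin a ≤∞ᵇ -∞ = false
fin a ≤∞ᵇ +∞ = true
fin a ≤∞ᵇ fin b = a ≤ᵇ b

_<∞ᵇ_ : ℤ∞ → ℤ∞ → Bool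
a <∞ᵇ b = not (b ≤∞ᵇ a)

-- Indices i are natural numbers (1-based, as in the paper); only
-- i ∈ I = {1,…,n-1} matter.  ⊥ is represented by `nothing`.
-- Weights are vectors in ℤ^n, i.e. functions Fin n → ℤ
-- (coordinate j (1-based) is stored at index j-1).

InI : ℕ → ℕ → Set
InI n i = 1 ≤ i × i < n

record QCData (n : ℕ) (X : Set) : Set where
  field
    e f : ℕ → X → Maybe X
    ε φ : ℕ → X → ℤ∞
    wt  : X → Fin n → ℤ

-- 1-based coordinate of a weight (0 outside 1..n)
coord : {n : ℕ} → (Fin n → ℤ) → ℕ → ℤ
coord {n} w zero = 0ℤ
coord {n} w (suc j) with j <? n
... | Relation.Nullary.yes p = w (fromℕ< p)
... | Relation.Nullary.no _ = 0ℤ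

⟨_,α_⟩ : {n : ℕ} → (Fin n → ℤ) → ℕ → ℤ
⟨ w ,α i ⟩ = coord w i - coord w (suc i)

-- The standard crystal B_n: letter a : Fin n stands for toℕ a + 1.

toFin : {n : ℕ} → ℕ → Maybe (Fin n)
toFin {n} m with m <? n
... | Relation.Nullary.yes p = just (fromℕ< p)
... | Relation.Nullary.no _ = nothing

δ : ℕ → ℕ → ℤ
δ a b = if a ≡ᵇ b then 1ℤ else 0ℤ

Bstd : (n : ℕ) → QCData n (Fin n)
Bstd n = record
  { e = λ i a → eB i a
  ; f = λ i a → if (toℕ a ℕ.+ 1) ≡ᵇ i then toFin (toℕ a ℕ.+ 1) else nothing
  ; ε = λ i a → fin (δ (suc i) (toℕ a ℕ.+ 1))
  ; φ = λ i a → fin (δ i (toℕ a ℕ.+ 1))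
  ; wt = λ a b → if does (a Fin.≟ b) then 1ℤ else 0ℤ
  }
  where
  eB : ℕ → Fin n → Maybe (Fin n)
  eB zero a = nothing
  eB (suc i) a = if toℕ a ≡ᵇ suc i then toFin i else nothing

_⊗Q_ : {n : ℕ} {X Y : Set} → QCData n X → QCData n Y → QCData n (X × Y)
_⊗Q_ {n} Q Q' = record
  { e = λ i xy → eT i xy
  ; f = λ i xy → fT i xy
  ; ε = λ i xy → εT i xy
  ; φ = λ i xy → φT i xy
  ; wt = λ { (x , x') b → wt Q x b ℤ.+ wt Q' x' b }
  }
  where
  open QCData
  infCase : ℕ → _ → Bool
  infCase i (x , x') = (fin 0ℤ <∞ᵇ φ Q i x) ∧ (fin 0ℤ <∞ᵇ ε Q' i x')
  eT : ℕ → _ → Maybe _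
  eT i (x , x') =
    if infCase i (x , x') then nothing
    else (if ε Q' i x' ≤∞ᵇ φ Q i x
          then map (λ z → z , x') (e Q i x)
          else map (λ z → x , z) (e Q' i x'))
  fT : ℕ → _ → Maybe _
  fT i (x , x') =
    if infCase i (x , x') then nothing
    else (if ε Q' i x' <∞ᵇ φ Q i x
          then map (λ z → z , x') (f Q i x)
          else map (λ z → x , z) (f Q' i x'))
  εT : ℕ → _ → ℤ∞
  εT i (x , x') =
    if infCase i (x , x') then +∞
    else max∞ (ε Q i x) (ε Q' i x' ⊕∞ (ℤ.- ⟨ wt Q x ,α i ⟩))
  φT : ℕ → _ → ℤ∞
  φT i (x , x') =
    if infCase i (x , x') then +∞
    else max∞ (φ Q i x ⊕∞ ⟨ wt Q' x' ,α i ⟩) (φ Q' i x')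

-- Quasi-tensor powers  B_n^{⊗̈k}  (k ≥ 1), left-nested:
--   B^{⊗1} = B_n,  B^{⊗(k+1)} = B^{⊗k} ⊗̈ B_n.
-- (k = 0 is not used; its carrier is empty.)

PowCarrier : ℕ → ℕ → Set
PowCarrier n zero = ⊥
PowCarrier n (suc zero) = Fin n
PowCarrier n (suc (suc k)) = PowCarrier n (suc k) × Fin n

Bpow : (n k : ℕ) → QCData n (PowCarrier n k)
Bpow n zero = record { e = λ _ () ; f = λ _ () ; ε = λ _ () ; φ = λ _ () ; wt = λ () }
Bpow n (suc zero) = Bstd n
Bpow n (suc (suc k)) = Bpow n (suc k) ⊗Q Bstd n

module _ {n : ℕ} {X : Set} (Q : QCData n X) where
  open QCData Q

  Edge : X → X → Set
  Edge x y = Σ ℕ λ i → InI n i × f i x ≡ just y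

  InComponent : X → X → Set
  InComponent x₀ y = EqClosure Edge x₀ y

  -- Local quasi-crystal axioms on a subset C ⊆ X (with restricted maps;
  -- C is closed under ë_i, f̈_i when C is a connected component).
  LQ1 : (X → Set) → Set
  LQ1 C = ∀ x → C x → ∀ i → InI n i → InI n (suc i) →
          (ε i x ≡ fin 0ℤ ⇔ φ (suc i) x ≡ fin 0ℤ)

  LQ2-1 : (X → Set) → Set
  LQ2-1 C = ∀ x y → C x → ∀ i j → InI n i → InI n j →
            (suc i < j ⊎ suc j < i) → e i x ≡ just y → ε j x ≡ ε j y

  LQ2-2 : (X → Set) → Set
  LQ2-2 C = ∀ x y → C x → ∀ i → InI n i → InI n (suc i) → e i x ≡ just y →
            ((¬ (ε (suc i) x ≡ ε (suc i) y)) ⇔ (ε (suc i) x ≡ +∞ × ε i y ≡ fin 0ℤ))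
            × (¬ (ε (suc i) x ≡ ε (suc i) y) → ¬ (ε (suc i) y ≡ fin 0ℤ))

  -- here i = suc j, so i - 1 = j
  LQ2-3 : (X → Set) → Set
  LQ2-3 C = ∀ x y → C x → ∀ j → InI n j → InI n (suc j) → e (suc j) x ≡ just y →
            ((¬ (φ j x ≡ φ j y)) ⇔ (φ j y ≡ +∞ × φ (suc j) x ≡ fin 0ℤ))
            × (¬ (φ j x ≡ φ j y) → ¬ (φ j x ≡ fin 0ℤ))

  LQ3 : (X → Set) → Set
  LQ3 C = ∀ x y z → C x → ∀ i j → InI n i → InI n j → ¬ (i ≡ j) →
          e i x ≡ just y → e j x ≡ just z →
          Σ X λ w → e j y ≡ just w × e i z ≡ just w

  LQ3' : (X → Set) → Set
  LQ3' C = ∀ x y z → C x → ∀ i j → InI n i → InI n j → ¬ (i ≡ j) →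
           f i x ≡ just y → f j x ≡ just z →
           Σ X λ w → f j y ≡ just w × f i z ≡ just w

  LocalAxioms : (X → Set) → Set
  LocalAxioms C = LQ1 C × LQ2-1 C × LQ2-2 C × LQ2-3 C × LQ3 C × LQ3' C

module Submission where

-- An element of B_n^{⊗̈(k+1)} is a word of k+1 letters, the last letter being the right-most
-- tensor factor.  Induction on the word shows that ε_i and φ_i are +∞ as soon as some letter i
-- precedes some letter i+1, and are otherwise the numbers of letters i+1 and i; in that case ë_i
-- turns the last i+1 into i and f̈_i turns the first i into i+1.  Each local axiom is then a
-- statement about how a single such letter change affects the letter counts and the occurrence
-- of the pattern "i before i+1", again proved by induction on the word.  None of this uses the
-- connected component, so the axioms hold on the whole power.

open import Defs
open import Data.Nat as ℕ using (ℕ; zero; suc; _≡ᵇ_; _<?_; _≤_)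
import Data.Nat.Properties as ℕP
open import Data.Integer as ℤ using (ℤ; +_; 0ℤ; 1ℤ)
import Data.Integer.Properties as ℤP
open import Data.Integer.Tactic.RingSolver using (solve-∀)
open import Data.Fin as Fin using (Fin; toℕ; fromℕ<)
import Data.Fin.Properties as FinP
open import Data.Bool using (Bool; true; false; if_then_else_; _∧_; _∨_; T)
open import Data.Bool.Properties
  using (∨-conicalˡ; ∨-conicalʳ; ∨-zeroʳ; ∧-zeroʳ; ∧-identityʳ; ∧-distribʳ-∨)
open import Data.Maybe using (Maybe; just; nothing; map)
open import Data.Product using (_×_; _,_; Σ; proj₁; proj₂)
import Data.Product as Product
open import Data.Sum using (_⊎_; inj₁; inj₂)
open import Function.Bundles using (mk⇔)
open import Relation.Nullary using (yes; no; contradiction)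
open import Relation.Binary.PropositionalEquality
open import Function using (_∘_)

-- The max∞ formulas of _⊗Q_ for a word followed by one letter c, where ε_i c, φ_i c ∈ {0, 1}
-- and ⟨wt x, α_i⟩ = count_i x − count_{i+1} x.
⊔-ε-unchanged : ∀ a m → + a ℤ.⊔ (0ℤ ℤ.+ ℤ.- (+ m ℤ.- + a)) ≡ + a
⊔-ε-unchanged a m =
  trans (cong (+ a ℤ.⊔_) (shift (+ a) (+ m))) (ℤP.i≥j⇒i⊔j≡i (ℤP.i-j≤i (+ a) (+ m)))
  where
  shift : ∀ (a m : ℤ) → 0ℤ ℤ.+ ℤ.- (m ℤ.- a) ≡ a ℤ.- m
  shift = solve-∀

⊔-ε-incremented : ∀ a → + a ℤ.⊔ (1ℤ ℤ.+ ℤ.- (0ℤ ℤ.- + a)) ≡ + suc a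
⊔-ε-incremented a =
  trans (cong (+ a ℤ.⊔_) (shift (+ a))) (ℤP.i≤j⇒i⊔j≡j (ℤP.i≤j+i (+ a) 1ℤ))
  where
  shift : ∀ (a : ℤ) → 1ℤ ℤ.+ ℤ.- (0ℤ ℤ.- a) ≡ 1ℤ ℤ.+ a
  shift = solve-∀

⊔-φ-incremented : ∀ m → (+ m ℤ.+ (1ℤ ℤ.- 0ℤ)) ℤ.⊔ 1ℤ ≡ + suc m
⊔-φ-incremented m =
  trans (cong (ℤ._⊔ 1ℤ) (ℤP.+-comm (+ m) 1ℤ)) (ℤP.i≥j⇒i⊔j≡i (ℤ.+≤+ (ℕ.s≤s ℕ.z≤n)))

⊔-φ-unchanged : ∀ m → (+ m ℤ.+ (0ℤ ℤ.- 0ℤ)) ℤ.⊔ 0ℤ ≡ + m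
⊔-φ-unchanged m =
  trans (cong (ℤ._⊔ 0ℤ) (ℤP.+-identityʳ (+ m))) (ℤP.i≥j⇒i⊔j≡i (ℤ.+≤+ ℕ.z≤n))

≡ᵇ-refl : ∀ a → (a ≡ᵇ a) ≡ true
≡ᵇ-refl zero = refl
≡ᵇ-refl (suc a) = ≡ᵇ-refl a

≡ᵇ-true⇒≡ : ∀ a b → (a ≡ᵇ b) ≡ true → a ≡ b
≡ᵇ-true⇒≡ a b eq = ℕP.≡ᵇ⇒≡ a b (subst T (sym eq) _)

≢⇒≡ᵇ-false : ∀ a b → a ≢ b → (a ≡ᵇ b) ≡ false
≢⇒≡ᵇ-false a b a≢b with a ≡ᵇ b in eq
... | true = contradiction (≡ᵇ-true⇒≡ a b eq) a≢b
... | false = refl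

∨-monoˡ-true : ∀ {a a'} b → (a ≡ true → a' ≡ true) → a ∨ b ≡ true → a' ∨ b ≡ true
∨-monoˡ-true {true} b a⇒a' _ rewrite a⇒a' refl = refl
∨-monoˡ-true {false} {a'} b _ b≡true rewrite b≡true = ∨-zeroʳ a'

∨-monoʳ-true : ∀ a {b b'} → (b ≡ true → b' ≡ true) → a ∨ b ≡ true → a ∨ b' ≡ true
∨-monoʳ-true true _ _ = refl
∨-monoʳ-true false b⇒b' = b⇒b'

∧-falseʳ : ∀ {a b} → a ∧ b ≡ false → a ≡ true → b ≡ false
∧-falseʳ a∧b≡false refl = a∧b≡false

∧-falseˡ : ∀ {a b} → a ∧ b ≡ false → b ≡ true → a ≡ false
∧-falseˡ {a} a∧b≡false refl = trans (sym (∧-identityʳ a)) a∧b≡false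

nonzero : ℕ → Bool
nonzero zero = false
nonzero (suc _) = true

nonzero≡false⇒≡0 : ∀ {m} → nonzero m ≡ false → m ≡ 0
nonzero≡false⇒≡0 {zero} _ = refl

nonzero⇒≢0 : ∀ {m} → nonzero m ≡ true → m ≢ 0
nonzero⇒≢0 {suc _} _ ()

nonzero-+ˡ : ∀ a b → nonzero b ≡ true → nonzero (a ℕ.+ b) ≡ true
nonzero-+ˡ zero b nz = nz
nonzero-+ˡ (suc a) b _ = refl

infinite-or : Bool → ℕ → ℤ∞
infinite-or b m = if b then +∞ else fin (+ m)

infinite-or≡0⇒≡0 : ∀ b {m} → infinite-or b m ≡ fin 0ℤ → m ≡ 0
infinite-or≡0⇒≡0 false refl = refl

infinite-or-suc≢0 : ∀ b {m} → infinite-or b (suc m) ≢ fin 0ℤ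
infinite-or-suc≢0 true ()
infinite-or-suc≢0 false ()

apart⇒distinct : ∀ {i j} → suc i ℕ.< j ⊎ suc j ℕ.< i → j ≢ i × j ≢ suc i × suc j ≢ i
apart⇒distinct (inj₁ i+1<j) =
  ℕP.>⇒≢ (ℕP.<⇒≤ i+1<j) , ℕP.>⇒≢ i+1<j , ℕP.>⇒≢ (ℕP.m≤n⇒m≤1+n (ℕP.<⇒≤ i+1<j))
apart⇒distinct (inj₂ j+1<i) =
  ℕP.<⇒≢ (ℕP.<⇒≤ j+1<i) , ℕP.<⇒≢ (ℕP.m≤n⇒m≤1+n (ℕP.<⇒≤ j+1<i)) , ℕP.<⇒≢ j+1<i

module Power (n : ℕ) where

  -- Word k has k+1 letters, so that the recursion on k starts at a single letter.
  Word : ℕ → Set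
  Word k = PowCarrier n (suc k)

  B : (k : ℕ) → QCData n (Word k)
  B k = Bpow n (suc k)

  letter : Fin n → ℕ
  letter c = toℕ c ℕ.+ 1

  isLetter : ℕ → Fin n → Bool
  isLetter j c = j ≡ᵇ letter c

  indicator : ℕ → Fin n → ℕ
  indicator j c = if isLetter j c then 1 else 0

  count : ∀ k → ℕ → Word k → ℕ
  count zero j c = indicator j c
  count (suc k) j (x , c) = indicator j c ℕ.+ count k j x

  -- blocked k i x: some letter i precedes some letter i+1 in x, which makes ε_i = φ_i = +∞.
  blocked : ∀ k → ℕ → Word k → Bool
  blocked zero i c = false
  blocked (suc k) i (x , c) = blocked k i x ∨ (isLetter (suc i) c ∧ nonzero (count k i x))

  letter≡suc : ∀ c → letter c ≡ suc (toℕ c)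
  letter≡suc c = ℕP.+-comm (toℕ c) 1

  isLetter-true⇒≡ : ∀ j c → isLetter j c ≡ true → j ≡ letter c
  isLetter-true⇒≡ j c = ≡ᵇ-true⇒≡ j (letter c)

  isLetter-≢ : ∀ j c → j ≢ letter c → isLetter j c ≡ false
  isLetter-≢ j c = ≢⇒≡ᵇ-false j (letter c)

  isLetter-≡ : ∀ j c → letter c ≡ j → isLetter j c ≡ true
  isLetter-≡ j c refl = ≡ᵇ-refl (letter c)

  indicator-≡ : ∀ j c → letter c ≡ j → indicator j c ≡ 1
  indicator-≡ j c c≡j rewrite isLetter-≡ j c c≡j = refl

  indicator-≢ : ∀ j c → j ≢ letter c → indicator j c ≡ 0
  indicator-≢ j c j≢c rewrite isLetter-≢ j c j≢c = refl

  coord-+ : ∀ (w v : Fin n → ℤ) j → coord (λ b → w b ℤ.+ v b) j ≡ coord w j ℤ.+ coord v j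
  coord-+ w v zero = refl
  coord-+ w v (suc j) with j <? n
  ... | yes _ = refl
  ... | no _ = refl

  coord-wt-letter : ∀ c j → coord (QCData.wt (Bstd n) c) j ≡ + indicator j c
  coord-wt-letter c zero rewrite letter≡suc c = refl
  coord-wt-letter c (suc j) with j <? n
  ... | no j≮n rewrite letter≡suc c
        | ≢⇒≡ᵇ-false j (toℕ c) (λ j≡c → j≮n (subst (ℕ._< n) (sym j≡c) (FinP.toℕ<n c))) = refl
  ... | yes j<n with c Fin.≟ fromℕ< j<n
  ...   | yes refl rewrite letter≡suc (fromℕ< j<n) | FinP.toℕ-fromℕ< j<n | ≡ᵇ-refl j = refl
  ...   | no c≢j rewrite letter≡suc c
          | ≢⇒≡ᵇ-false j (toℕ c)
              (λ j≡c → c≢j (FinP.toℕ-injective (trans (sym j≡c) (sym (FinP.toℕ-fromℕ< j<n))))) = refl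

  coord-wt≡count : ∀ k (x : Word k) j → coord (QCData.wt (B k) x) j ≡ + count k j x
  coord-wt≡count zero c j = coord-wt-letter c j
  coord-wt≡count (suc k) (x , c) j
    rewrite coord-+ (QCData.wt (B k) x) (QCData.wt (Bstd n) c) j
          | coord-wt≡count k x j | coord-wt-letter c j =
    cong +_ (ℕP.+-comm (count k j x) (indicator j c))

  ε≡ : ∀ k i x → QCData.ε (B k) i x ≡ infinite-or (blocked k i x) (count k (suc i) x)
  φ≡ : ∀ k i x → QCData.φ (B k) i x ≡ infinite-or (blocked k i x) (count k i x)
  ε≡ zero i c with suc i ≡ᵇ letter c
  ... | true = refl
  ... | false = refl
  ε≡ (suc k) i (x , c)
    rewrite ε≡ k i x | φ≡ k i x | coord-wt≡count k x i | coord-wt≡count k x (suc i)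
    with blocked k i x | suc i ≡ᵇ letter c | count k i x
  ... | true | true | _ = refl
  ... | true | false | _ = refl
  ... | false | true | zero = cong fin (⊔-ε-incremented (count k (suc i) x))
  ... | false | true | suc _ = refl
  ... | false | false | zero = cong fin (⊔-ε-unchanged (count k (suc i) x) 0)
  ... | false | false | suc m = cong fin (⊔-ε-unchanged (count k (suc i) x) (suc m))
  φ≡ zero i c with i ≡ᵇ letter c
  ... | true = refl
  ... | false = refl
  φ≡ (suc k) i (x , c) rewrite φ≡ k i x | coord-wt-letter c i | coord-wt-letter c (suc i)
    with blocked k i x | suc i ≡ᵇ letter c in c≡i+1 | i ≡ᵇ letter c in c≡i | count k i x
  ... | true | true | _ | _ = refl
  ... | true | false | _ | _ = refl
  ... | false | true | true | _ =
    contradiction (trans (≡ᵇ-true⇒≡ (suc i) (letter c) c≡i+1) (sym (≡ᵇ-true⇒≡ i (letter c) c≡i)))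
                  ℕP.1+n≢n
  ... | false | true | false | zero = refl
  ... | false | true | false | suc _ = refl
  ... | false | false | true | zero = cong fin (⊔-φ-incremented 0)
  ... | false | false | true | suc m = cong fin (⊔-φ-incremented (suc m))
  ... | false | false | false | zero = cong fin (⊔-φ-unchanged 0)
  ... | false | false | false | suc m = cong fin (⊔-φ-unchanged (suc m))

  eLetter fLetter : ℕ → Fin n → Maybe (Fin n)
  eLetter = QCData.e (Bstd n)
  fLetter = QCData.f (Bstd n)

  eLetter-letters : ∀ i c {c'} → eLetter i c ≡ just c' → letter c ≡ suc i × letter c' ≡ i
  eLetter-letters (suc i) c h with toℕ c ≡ᵇ suc i in c≡i+1 | i <? n
  eLetter-letters (suc i) c refl | true | yes i<n =
    trans (letter≡suc c) (cong suc (≡ᵇ-true⇒≡ _ _ c≡i+1)) ,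
    trans (letter≡suc _) (cong suc (FinP.toℕ-fromℕ< i<n))

  fLetter-letters : ∀ i c {c'} → fLetter i c ≡ just c' → letter c ≡ i × letter c' ≡ suc i
  fLetter-letters i c h with letter c ≡ᵇ i in c≡i | letter c <? n
  fLetter-letters i c refl | true | yes c+1<n =
    ≡ᵇ-true⇒≡ _ _ c≡i ,
    trans (letter≡suc _) (cong suc (trans (FinP.toℕ-fromℕ< c+1<n) (≡ᵇ-true⇒≡ _ _ c≡i)))

  eWord fWord : ∀ k → ℕ → Word k → Maybe (Word k)
  eWord k = QCData.e (B k)
  fWord k = QCData.f (B k)

  mutual
    eWord-snoc : ∀ k i x c → eWord (suc k) i (x , c) ≡
      (if blocked (suc k) i (x , c) then nothing
       else if isLetter (suc i) c then map (x ,_) (eLetter i c) else map (_, c) (eWord k i x))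
    eWord-snoc k i x c rewrite φ≡ k i x with blocked k i x in bl | isLetter (suc i) c | count k i x
    ... | true | true | _ = refl
    ... | true | false | _ = cong (map (_, c)) (eWord-blocked k i x bl)
    ... | false | true | zero = refl
    ... | false | true | suc _ = refl
    ... | false | false | zero = refl
    ... | false | false | suc _ = refl

    eWord-blocked : ∀ k i x → blocked k i x ≡ true → eWord k i x ≡ nothing
    eWord-blocked (suc k) i (x , c) bl rewrite eWord-snoc k i x c | bl = refl

  mutual
    fWord-snoc : ∀ k i x c → fWord (suc k) i (x , c) ≡
      (if blocked (suc k) i (x , c) then nothing
       else if nonzero (count k i x) then map (_, c) (fWord k i x) else map (x ,_) (fLetter i c))
    fWord-snoc k i x c rewrite φ≡ k i x with blocked k i x in bl | isLetter (suc i) c | count k i x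
    ... | true | true | _ = refl
    ... | true | false | _ = cong (map (_, c)) (fWord-blocked k i x bl)
    ... | false | true | zero = refl
    ... | false | true | suc _ = refl
    ... | false | false | zero = refl
    ... | false | false | suc _ = refl

    fWord-blocked : ∀ k i x → blocked k i x ≡ true → fWord k i x ≡ nothing
    fWord-blocked (suc k) i (x , c) bl rewrite fWord-snoc k i x c | bl = refl

  data Snoc {k} (x : Word k) (c : Fin n) (AtLast AtInit : Set)
              (mc : Maybe (Fin n)) (mx : Maybe (Word k)) : Word (suc k) → Set where
    at-last : ∀ {c'} → AtLast → mc ≡ just c' → Snoc x c AtLast AtInit mc mx (x , c')
    at-init : ∀ {x'} → AtInit → mx ≡ just x' → Snoc x c AtLast AtInit mc mx (x' , c)

  EView : ∀ k → ℕ → Word k → Fin n → Word (suc k) → Set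
  EView k i x c =
    Snoc x c (isLetter (suc i) c ≡ true) (isLetter (suc i) c ≡ false) (eLetter i c) (eWord k i x)

  FView : ∀ k → ℕ → Word k → Fin n → Word (suc k) → Set
  FView k i x c =
    Snoc x c (nonzero (count k i x) ≡ false) (nonzero (count k i x) ≡ true) (fLetter i c) (fWord k i x)

  e-view : ∀ k i x c {y} → eWord (suc k) i (x , c) ≡ just y →
           blocked (suc k) i (x , c) ≡ false × EView k i x c y
  e-view k i x c h = view _ _ (trans (sym (eWord-snoc k i x c)) h)
    where
    view : ∀ b l {mc mx y} → (if b then nothing else if l then map (x ,_) mc else map (_, c) mx) ≡ just y →
           b ≡ false × Snoc x c (l ≡ true) (l ≡ false) mc mx y
    view false true {just _} refl = refl , at-last refl refl
    view false false {mx = just _} refl = refl , at-init refl refl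
    view true _ ()
    view false true {nothing} ()
    view false false {mx = nothing} ()

  f-view : ∀ k i x c {y} → fWord (suc k) i (x , c) ≡ just y →
           blocked (suc k) i (x , c) ≡ false × FView k i x c y
  f-view k i x c h = view _ _ (trans (sym (fWord-snoc k i x c)) h)
    where
    view : ∀ b l {mc mx y} → (if b then nothing else if l then map (_, c) mx else map (x ,_) mc) ≡ just y →
           b ≡ false × Snoc x c (l ≡ false) (l ≡ true) mc mx y
    view false false {just _} refl = refl , at-last refl refl
    view false true {mx = just _} refl = refl , at-init refl refl
    view true _ ()
    view false false {nothing} ()
    view false true {mx = nothing} ()

  blocked⇒nonzero-counts : ∀ k i x → blocked k i x ≡ true →
    nonzero (count k i x) ≡ true × nonzero (count k (suc i) x) ≡ true
  blocked⇒nonzero-counts (suc k) i (x , c) bl with blocked k i x in blx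
  ... | true = Product.map (nonzero-+ˡ _ _) (nonzero-+ˡ _ _) (blocked⇒nonzero-counts k i x blx)
  ... | false with isLetter (suc i) c | nonzero (count k i x) in nzi
  ...   | true | true = nonzero-+ˡ _ _ nzi , refl

  no-i⇒unblocked : ∀ k i x → nonzero (count k i x) ≡ false → blocked k i x ≡ false
  no-i⇒unblocked k i x z with blocked k i x in bl
  ... | false = refl
  ... | true = trans (sym (proj₁ (blocked⇒nonzero-counts k i x bl))) z

  no-i+1⇒unblocked : ∀ k i x → nonzero (count k (suc i) x) ≡ false → blocked k i x ≡ false
  no-i+1⇒unblocked k i x z with blocked k i x in bl
  ... | false = refl
  ... | true = trans (sym (proj₂ (blocked⇒nonzero-counts k i x bl))) z

  eWord-unblocked : ∀ k i x {y} → eWord k i x ≡ just y → blocked k i x ≡ false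
  eWord-unblocked k i x h with blocked k i x in bl
  ... | false = refl
  ... | true with () ← trans (sym h) (eWord-blocked k i x bl)

  fWord-unblocked : ∀ k i x {y} → fWord k i x ≡ just y → blocked k i x ≡ false
  fWord-unblocked k i x h with blocked k i x in bl
  ... | false = refl
  ... | true with () ← trans (sym h) (fWord-blocked k i x bl)

  unblocked-snoc⁻ : ∀ k i x c → blocked (suc k) i (x , c) ≡ false →
    blocked k i x ≡ false × (isLetter (suc i) c ∧ nonzero (count k i x)) ≡ false
  unblocked-snoc⁻ k i x c bl = ∨-conicalˡ _ _ bl , ∨-conicalʳ _ _ bl

  unblocked-snoc-other : ∀ k i x c → blocked k i x ≡ false → isLetter (suc i) c ≡ false →
    blocked (suc k) i (x , c) ≡ false
  unblocked-snoc-other k i x c bl l rewrite bl | l = refl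

  unblocked-snoc-no-i : ∀ k i x c → blocked k i x ≡ false → nonzero (count k i x) ≡ false →
    blocked (suc k) i (x , c) ≡ false
  unblocked-snoc-no-i k i x c bl z rewrite bl | z | ∧-zeroʳ (isLetter (suc i) c) = refl

  e-at-last : ∀ k i x c {c'} → blocked (suc k) i (x , c) ≡ false → isLetter (suc i) c ≡ true →
    eLetter i c ≡ just c' → eWord (suc k) i (x , c) ≡ just (x , c')
  e-at-last k i x c bl l h rewrite eWord-snoc k i x c | bl | l | h = refl

  e-at-init : ∀ k i x c {x'} → blocked (suc k) i (x , c) ≡ false → isLetter (suc i) c ≡ false →
    eWord k i x ≡ just x' → eWord (suc k) i (x , c) ≡ just (x' , c)
  e-at-init k i x c bl l h rewrite eWord-snoc k i x c | bl | l | h = refl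

  f-at-last : ∀ k i x c {c'} → blocked (suc k) i (x , c) ≡ false → nonzero (count k i x) ≡ false →
    fLetter i c ≡ just c' → fWord (suc k) i (x , c) ≡ just (x , c')
  f-at-last k i x c bl z h rewrite fWord-snoc k i x c | bl | z | h = refl

  f-at-init : ∀ k i x c {x'} → blocked (suc k) i (x , c) ≡ false → nonzero (count k i x) ≡ true →
    fWord k i x ≡ just x' → fWord (suc k) i (x , c) ≡ just (x' , c)
  f-at-init k i x c bl nz h rewrite fWord-snoc k i x c | bl | nz | h = refl

  -- Lowers i u v: the letter counts v arise from u by turning one letter i+1 into i.
  Lowers : ℕ → (ℕ → ℕ) → (ℕ → ℕ) → Set
  Lowers i u v =
    u (suc i) ≡ suc (v (suc i)) × v i ≡ suc (u i) × (∀ m → m ≢ i → m ≢ suc i → v m ≡ u m)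

  Lowers-+ˡ : ∀ {i u v} (w : ℕ → ℕ) → Lowers i u v →
    Lowers i (λ j → w j ℕ.+ u j) (λ j → w j ℕ.+ v j)
  Lowers-+ˡ {i} w (up , down , others) =
    trans (cong (w (suc i) ℕ.+_) up) (ℕP.+-suc _ _) ,
    trans (cong (w i ℕ.+_) down) (ℕP.+-suc _ _) ,
    λ m m≢i m≢i+1 → cong (w m ℕ.+_) (others m m≢i m≢i+1)

  Lowers-+ʳ : ∀ {i u v} (w : ℕ → ℕ) → Lowers i u v →
    Lowers i (λ j → u j ℕ.+ w j) (λ j → v j ℕ.+ w j)
  Lowers-+ʳ {i} w (up , down , others) =
    cong (ℕ._+ w (suc i)) up , cong (ℕ._+ w i) down ,
    λ m m≢i m≢i+1 → cong (ℕ._+ w m) (others m m≢i m≢i+1)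

  letters-lower : ∀ i c c' → letter c ≡ suc i → letter c' ≡ i →
    Lowers i (λ j → indicator j c) (λ j → indicator j c')
  letters-lower i c c' c≡i+1 c'≡i
    rewrite indicator-≡ (suc i) c c≡i+1 | indicator-≢ (suc i) c' (λ e → ℕP.1+n≢n (trans e c'≡i))
          | indicator-≡ i c' c'≡i | indicator-≢ i c (λ e → ℕP.1+n≢n (sym (trans e c≡i+1))) =
    refl , refl ,
    λ m m≢i m≢i+1 → trans (indicator-≢ m c' (λ e → m≢i (trans e c'≡i)))
                          (sym (indicator-≢ m c (λ e → m≢i+1 (trans e c≡i+1))))

  eLetter-counts : ∀ i c {c'} → eLetter i c ≡ just c' →
    Lowers i (λ j → indicator j c) (λ j → indicator j c')
  eLetter-counts i c h = Product.uncurry (letters-lower i c _) (eLetter-letters i c h)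

  fLetter-counts : ∀ i c {c'} → fLetter i c ≡ just c' →
    Lowers i (λ j → indicator j c') (λ j → indicator j c)
  fLetter-counts i c h with fLetter-letters i c h
  ... | c≡i , c'≡i+1 = letters-lower i _ c c'≡i+1 c≡i

  eWord-counts : ∀ k i x {y} → eWord k i x ≡ just y → Lowers i (λ j → count k j x) (λ j → count k j y)
  eWord-counts zero i c h = eLetter-counts i c h
  eWord-counts (suc k) i (x , c) h with e-view k i x c h
  ... | _ , at-last _ h′ = Lowers-+ʳ (λ j → count k j x) (eLetter-counts i c h′)
  ... | _ , at-init _ h′ = Lowers-+ˡ (λ j → indicator j c) (eWord-counts k i x h′)

  fWord-counts : ∀ k i x {y} → fWord k i x ≡ just y → Lowers i (λ j → count k j y) (λ j → count k j x)
  fWord-counts zero i c h = fLetter-counts i c h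
  fWord-counts (suc k) i (x , c) h with f-view k i x c h
  ... | _ , at-last _ h′ = Lowers-+ʳ (λ j → count k j x) (fLetter-counts i c h′)
  ... | _ , at-init _ h′ = Lowers-+ˡ (λ j → indicator j c) (fWord-counts k i x h′)

  eWord-blocked-far : ∀ k i j x {y} → j ≢ i → j ≢ suc i → suc j ≢ i → eWord k i x ≡ just y →
    blocked k j y ≡ blocked k j x
  eWord-blocked-far zero i j c _ _ _ _ = refl
  eWord-blocked-far (suc k) i j (x , c) j≢i j≢i+1 j+1≢i h with e-view k i x c h
  ... | _ , at-last _ h′ with eLetter-letters i c h′
  ...   | c≡i+1 , c'≡i
    rewrite isLetter-≢ (suc j) _ (λ e → j+1≢i (trans e c'≡i))
          | isLetter-≢ (suc j) c (λ e → j≢i (ℕP.suc-injective (trans e c≡i+1))) = refl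
  eWord-blocked-far (suc k) i j (x , c) j≢i j≢i+1 j+1≢i h | _ , at-init _ h′
    rewrite eWord-blocked-far k i j x j≢i j≢i+1 j+1≢i h′
          | proj₂ (proj₂ (eWord-counts k i x h′)) j j≢i j≢i+1 = refl

  eWord-blocked-above : ∀ k i x {y} → eWord k i x ≡ just y →
    blocked k (suc i) y ≡ (blocked k (suc i) x ∧ nonzero (count k (suc i) y))
  eWord-blocked-above zero i c _ = refl
  eWord-blocked-above (suc k) i (x , c) h with e-view k i x c h
  ... | _ , at-last _ h′ with eLetter-letters i c h′
  ...   | c≡i+1 , c'≡i
    rewrite isLetter-≢ (suc (suc i)) _ (λ e → ℕP.m≢1+n+m i (sym (trans e c'≡i)))
          | isLetter-≢ (suc (suc i)) c (λ e → ℕP.1+n≢n (ℕP.suc-injective (trans e c≡i+1)))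
          | indicator-≢ (suc i) _ (λ e → ℕP.1+n≢n (trans e c'≡i))
    with blocked k (suc i) x in bl
  ...     | true rewrite proj₁ (blocked⇒nonzero-counts k (suc i) x bl) = refl
  ...     | false = refl
  eWord-blocked-above (suc k) i (x , c) h | _ , at-init {x'} l h′
    rewrite eWord-blocked-above k i x h′ | proj₁ (eWord-counts k i x h′) | l
          | ∧-identityʳ (isLetter (suc (suc i)) c) =
    sym (∧-distribʳ-∨ (nonzero (count k (suc i) x')) (blocked k (suc i) x) (isLetter (suc (suc i)) c))

  eWord-keeps-blocked-below : ∀ k j x {y} → eWord k (suc j) x ≡ just y →
    blocked k j x ≡ true → blocked k j y ≡ true
  eWord-keeps-blocked-below (suc k) j (x , c) h with e-view k (suc j) x c h
  ... | _ , at-last _ h′ with eLetter-letters (suc j) c h′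
  ...   | c≡j+2 , c'≡j+1
    rewrite isLetter-≢ (suc j) c (λ e → ℕP.1+n≢n (sym (trans e c≡j+2)))
          | isLetter-≡ (suc j) _ c'≡j+1 =
    ∨-monoʳ-true (blocked k j x) λ ()
  eWord-keeps-blocked-below (suc k) j (x , c) h | _ , at-init _ h′
    rewrite proj₂ (proj₂ (eWord-counts k (suc j) x h′)) j
              (λ e → ℕP.1+n≢n (sym e)) (ℕP.m≢1+n+m j) =
    ∨-monoˡ-true _ (eWord-keeps-blocked-below k j x h′)

  -- A letter j+1 of x would follow the letter changed by ë_{j+1}, so the j before it would
  -- already block x.
  eWord-creates-blocked-below : ∀ k j x {y} → eWord k (suc j) x ≡ just y →
    blocked k j y ≡ true → blocked k j x ≡ false → count k (suc j) x ≡ 0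
  eWord-creates-blocked-below (suc k) j (x , c) h with e-view k (suc j) x c h
  ... | unblocked , at-last l h′ with eLetter-letters (suc j) c h′
  ...   | c≡j+2 , _ rewrite indicator-≢ (suc j) c (λ e → ℕP.1+n≢n (sym (trans e c≡j+2))) =
    λ _ _ → nonzero≡false⇒≡0 (∧-falseʳ (proj₂ (unblocked-snoc⁻ k (suc j) x c unblocked)) l)
  eWord-creates-blocked-below (suc k) j (x , c) h | _ , at-init {x'} _ h′
    with proj₂ (proj₂ (eWord-counts k (suc j) x h′)) j (λ e → ℕP.1+n≢n (sym e)) (ℕP.m≢1+n+m j)
  ... | same-i
    with blocked k j x' in bx' | blocked k j x in bx | isLetter (suc j) c | nonzero (count k j x) in nz
  ... | _ | true | _ | _ = λ _ ()
  ... | true | false | false | _ = λ _ _ → eWord-creates-blocked-below k j x h′ bx' bx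
  ... | true | false | true | true = λ _ ()
  ... | true | false | true | false
    with () ← trans (sym nz) (trans (cong nonzero (sym same-i)) (proj₁ (blocked⇒nonzero-counts k j x' bx')))
  ... | false | false | _ | _ rewrite same-i | nz = λ hy hx → contradiction (trans (sym hy) hx) λ ()

  e-last-commutes-with-init : ∀ k i j x c {c' z'} → i ≢ j → blocked (suc k) i (x , c) ≡ false →
    isLetter (suc i) c ≡ true → eLetter i c ≡ just c' → eWord k j x ≡ just z' →
    eWord (suc k) j (x , c') ≡ just (z' , c') × eWord (suc k) i (z' , c) ≡ just (z' , c')
  e-last-commutes-with-init k i j x c {c'} {z'} i≢j unblocked l h hj =
    e-at-init k j x c' (unblocked-snoc-other k j x c' (eWord-unblocked k j x hj) c'≢j+1) c'≢j+1 hj ,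
    e-at-last k i z' c (unblocked-snoc-no-i k i z' c (no-i⇒unblocked k i z' no-i) no-i) l h
    where
    no-i-in-x : count k i x ≡ 0
    no-i-in-x = nonzero≡false⇒≡0 (∧-falseʳ (proj₂ (unblocked-snoc⁻ k i x c unblocked)) l)
    i≢j+1 : i ≢ suc j
    i≢j+1 refl with () ← trans (sym no-i-in-x) (proj₁ (eWord-counts k j x hj))
    c'≢j+1 : isLetter (suc j) c' ≡ false
    c'≢j+1 = isLetter-≢ (suc j) c' (λ e → i≢j+1 (sym (trans e (proj₂ (eLetter-letters i c h)))))
    no-i : nonzero (count k i z') ≡ false
    no-i = cong nonzero (trans (proj₂ (proj₂ (eWord-counts k j x hj)) i i≢j i≢j+1) no-i-in-x)

  eWord-commute : ∀ k i j x {y z} → i ≢ j → eWord k i x ≡ just y → eWord k j x ≡ just z →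
    Σ (Word k) λ w → eWord k j y ≡ just w × eWord k i z ≡ just w
  eWord-commute zero i j c i≢j hi hj =
    contradiction (ℕP.suc-injective (trans (sym (proj₁ (eLetter-letters i c hi)))
                                           (proj₁ (eLetter-letters j c hj)))) i≢j
  eWord-commute (suc k) i j (x , c) i≢j hi hj with e-view k i x c hi | e-view k j x c hj
  ... | _ , at-last li _ | _ , at-last lj _ =
    contradiction (ℕP.suc-injective (trans (isLetter-true⇒≡ _ c li) (sym (isLetter-true⇒≡ _ c lj)))) i≢j
  ... | unblocked , at-last l h | _ , at-init _ h′ =
    _ , e-last-commutes-with-init k i j x c i≢j unblocked l h h′
  ... | _ , at-init _ h′ | unblocked , at-last l h =
    _ , Product.swap (e-last-commutes-with-init k j i x c (≢-sym i≢j) unblocked l h h′)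
  ... | _ , at-init {y'} li h′ | _ , at-init {z'} lj h″ with eWord-commute k i j x i≢j h′ h″
  ...   | w , hjy , hiz =
    (w , c) ,
    e-at-init k j y' c (unblocked-snoc-other k j y' c (eWord-unblocked k j y' hjy) lj) lj hjy ,
    e-at-init k i z' c (unblocked-snoc-other k i z' c (eWord-unblocked k i z' hiz) li) li hiz

  f-init-commutes-with-last : ∀ k i j x c {c' y'} → i ≢ j → blocked (suc k) i (x , c) ≡ false →
    nonzero (count k i x) ≡ true → fWord k i x ≡ just y' →
    nonzero (count k j x) ≡ false → fLetter j c ≡ just c' →
    fWord (suc k) j (y' , c) ≡ just (y' , c') × fWord (suc k) i (x , c') ≡ just (y' , c')
  f-init-commutes-with-last k i j x c {c'} {y'} i≢j unblocked has-i hi no-j hj =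
    f-at-last k j y' c (unblocked-snoc-no-i k j y' c (no-i⇒unblocked k j y' no-j-in-y') no-j-in-y') no-j-in-y' hj ,
    f-at-init k i x c'
      (unblocked-snoc-other k i x c' (proj₁ (unblocked-snoc⁻ k i x c unblocked)) c'≢i+1) has-i hi
    where
    j≢i+1 : j ≢ suc i
    j≢i+1 j≡i+1 with () ← trans (sym (isLetter-≡ (suc i) c (trans (proj₁ (fLetter-letters j c hj)) j≡i+1)))
                                (∧-falseˡ (proj₂ (unblocked-snoc⁻ k i x c unblocked)) has-i)
    no-j-in-y' : nonzero (count k j y') ≡ false
    no-j-in-y' = trans (cong nonzero (sym (proj₂ (proj₂ (fWord-counts k i x hi)) j (≢-sym i≢j) j≢i+1))) no-j
    c'≢i+1 : isLetter (suc i) c' ≡ false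
    c'≢i+1 =
      isLetter-≢ (suc i) c' (λ e → i≢j (ℕP.suc-injective (trans e (proj₂ (fLetter-letters j c hj)))))

  f-init-after-init : ∀ k i j x c {y' w'} → j ≢ i → blocked (suc k) j (x , c) ≡ false →
    nonzero (count k j x) ≡ true → fWord k i x ≡ just y' → fWord k j y' ≡ just w' →
    fWord (suc k) j (y' , c) ≡ just (w' , c)
  f-init-after-init k i j x c {y'} j≢i unblocked has-j hi hj =
    f-at-init k j y' c (unblocked-snoc-other k j y' c (fWord-unblocked k j y' hj) c≢j+1) has-j-in-y' hj
    where
    c≢j+1 : isLetter (suc j) c ≡ false
    c≢j+1 = ∧-falseˡ (proj₂ (unblocked-snoc⁻ k j x c unblocked)) has-j
    has-j-in-y' : nonzero (count k j y') ≡ true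
    has-j-in-y' with j ℕ.≟ suc i
    ... | yes refl = cong nonzero (proj₁ (fWord-counts k i x hi))
    ... | no j≢i+1 = trans (cong nonzero (sym (proj₂ (proj₂ (fWord-counts k i x hi)) j j≢i j≢i+1))) has-j

  fWord-commute : ∀ k i j x {y z} → i ≢ j → fWord k i x ≡ just y → fWord k j x ≡ just z →
    Σ (Word k) λ w → fWord k j y ≡ just w × fWord k i z ≡ just w
  fWord-commute zero i j c i≢j hi hj =
    contradiction (trans (sym (proj₁ (fLetter-letters i c hi))) (proj₁ (fLetter-letters j c hj))) i≢j
  fWord-commute (suc k) i j (x , c) i≢j hi hj with f-view k i x c hi | f-view k j x c hj
  ... | _ , at-last _ h | _ , at-last _ h′ =
    contradiction (trans (sym (proj₁ (fLetter-letters i c h))) (proj₁ (fLetter-letters j c h′))) i≢j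
  ... | unblocked , at-init has-i h | _ , at-last no-j h′ =
    _ , f-init-commutes-with-last k i j x c i≢j unblocked has-i h no-j h′
  ... | _ , at-last no-i h′ | unblocked , at-init has-j h =
    _ , Product.swap (f-init-commutes-with-last k j i x c (≢-sym i≢j) unblocked has-j h no-i h′)
  ... | unblocked-i , at-init has-i h | unblocked-j , at-init has-j h′ with fWord-commute k i j x i≢j h h′
  ...   | w , hjy , hiz =
    (w , c) ,
    f-init-after-init k i j x c (≢-sym i≢j) unblocked-j has-j h hjy ,
    f-init-after-init k j i x c i≢j unblocked-i has-i h′ hiz

  power-LQ1 : ∀ k C → LQ1 (B k) C
  power-LQ1 k C x _ i _ _ rewrite ε≡ k i x | φ≡ k (suc i) x =
    mk⇔ (λ ε≡0 → zero-at (suc i) (no-i⇒unblocked k (suc i) x) (infinite-or≡0⇒≡0 _ ε≡0))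
        (λ φ≡0 → zero-at i (no-i+1⇒unblocked k i x) (infinite-or≡0⇒≡0 _ φ≡0))
    where
    zero-at : ∀ j → (nonzero (count k (suc i) x) ≡ false → blocked k j x ≡ false) →
      count k (suc i) x ≡ 0 → infinite-or (blocked k j x) (count k (suc i) x) ≡ fin 0ℤ
    zero-at j unblocked no-i+1 rewrite unblocked (cong nonzero no-i+1) | no-i+1 = refl

  power-LQ2-1 : ∀ k C → LQ2-1 (B k) C
  power-LQ2-1 k C x y _ i j _ _ apart h with apart⇒distinct apart
  ... | j≢i , j≢i+1 , j+1≢i rewrite ε≡ k j x | ε≡ k j y =
    cong₂ infinite-or (sym (eWord-blocked-far k i j x j≢i j≢i+1 j+1≢i h))
                      (sym (proj₂ (proj₂ (eWord-counts k i x h)) (suc j) j+1≢i (j≢i ∘ ℕP.suc-injective)))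

  power-LQ2-2 : ∀ k C → LQ2-2 (B k) C
  power-LQ2-2 k C x y _ i _ _ h
    rewrite ε≡ k (suc i) x | ε≡ k (suc i) y | ε≡ k i y
          | proj₂ (proj₂ (eWord-counts k i x h)) (suc (suc i)) (ℕP.m≢1+n+m i ∘ sym) ℕP.1+n≢n
          | eWord-blocked-above k i x h
    with blocked k (suc i) x in bl | count k (suc i) y in no-i+1
  ... | false | _ = mk⇔ (contradiction refl) (λ ()) , contradiction refl
  ... | true | suc _ =
    mk⇔ (contradiction refl) (λ (_ , ε≡0) → contradiction ε≡0 (infinite-or-suc≢0 _)) , contradiction refl
  ... | true | zero rewrite no-i+1⇒unblocked k i y (cong nonzero no-i+1) =
    mk⇔ (λ _ → refl , refl) (λ _ ()) ,
    λ _ ε≡0 → nonzero⇒≢0 (proj₂ (blocked⇒nonzero-counts k (suc i) x bl))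
                          (infinite-or≡0⇒≡0 false ε≡0)

  power-LQ2-3 : ∀ k C → LQ2-3 (B k) C
  power-LQ2-3 k C x y _ j _ _ h
    with proj₂ (proj₂ (eWord-counts k (suc j) x h)) j (ℕP.1+n≢n ∘ sym) (ℕP.m≢1+n+m j)
  ... | same-j
    rewrite φ≡ k j x | φ≡ k j y | φ≡ k (suc j) x | eWord-unblocked k (suc j) x h | same-j
    with blocked k j x in bx | blocked k j y in by
  ... | true | true =
    mk⇔ (contradiction refl)
        (λ (_ , φ≡0) → contradiction (infinite-or≡0⇒≡0 false φ≡0)
                                     (nonzero⇒≢0 (proj₂ (blocked⇒nonzero-counts k j x bx)))) ,
    contradiction refl
  ... | true | false with () ← trans (sym (eWord-keeps-blocked-below k j x h bx)) by
  ... | false | false = mk⇔ (contradiction refl) (λ ()) , contradiction refl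
  ... | false | true =
    mk⇔ (λ _ → refl , cong (λ m → fin (+ m)) (eWord-creates-blocked-below k j x h by bx)) (λ _ ()) ,
    λ _ φ≡0 → nonzero⇒≢0 (trans (cong nonzero (sym same-j)) (proj₁ (blocked⇒nonzero-counts k j y by)))
                         (infinite-or≡0⇒≡0 false φ≡0)

  power-LQ3 : ∀ k C → LQ3 (B k) C
  power-LQ3 k C x _ _ _ i j _ _ i≢j = eWord-commute k i j x i≢j

  power-LQ3' : ∀ k C → LQ3' (B k) C
  power-LQ3' k C x _ _ _ i j _ _ i≢j = fWord-commute k i j x i≢j

  power-LocalAxioms : ∀ k C → LocalAxioms (B k) C
  power-LocalAxioms k C =
    power-LQ1 k C , power-LQ2-1 k C , power-LQ2-2 k C , power-LQ2-3 k C , power-LQ3 k C , power-LQ3' k C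

corollary3p14 : (n : ℕ) → 2 ≤ n → (k : ℕ) → 1 ≤ k →
    (x₀ : PowCarrier n k) → LocalAxioms (Bpow n k) (InComponent (Bpow n k) x₀)
corollary3p14 n _ (suc k) _ x₀ = Power.power-LocalAxioms n k (InComponent (Bpow n (suc k)) x₀)
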